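{- If $D\in\mathcal{F}$, then: if there is no arc $c\to a$, there is an arc $b\to a$; and if there is no arc $c\to b$, there is an arc $a\to b$.
   Context: An oriented graph is a loopless directed graph with no pair of opposite arcs. Strong diameter $2$: for every ordered pair of distinct vertices $(i,j)$ there is a directed path from $i$ to $j$ of length at most $2$. 2-connected: strong connectivity at least $2$. Paths are simple directed paths. $\mathcal{F}$ is the set of 2-connected oriented graphs $D$ with strong diameter $2$ having six distinct vertices $p,q,a,b,c,r$ such that: arcs $p\to c$, $q\to c$, $q\to b$, $b\to r$, $a\to r$, $p\to a$ are present; every directed path from $p$ to $r$ contains $a$ or contains both $c$ and $b$; every directed path from $q$ to $r$ contains $b$ or contains both $c$ and $a$; every directed path from $c$ to $r$ contains $a$ or $b$. -}

module Defs where

open import Data.Nat using (ℕ; zero; suc; _≤_)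
open import Data.Fin using (Fin)
open import Data.Bool using (Bool; true; false)
open import Data.List using (List; []; _∷_; length)
open import Data.List.Membership.Propositional using (_∈_)
open import Data.List.Relation.Unary.Unique.Propositional using (Unique)
open import Data.Product using (Σ; _×_; _,_; ∃-syntax)
open import Data.Sum using (_⊎_)
open import Relation.Binary.PropositionalEquality using (_≡_; _≢_)
open import Relation.Nullary using (¬_)

record OrientedGraph : Set where
  field
    n        : ℕ
    arc      : Fin n → Fin n → Bool
    loopless : ∀ x → arc x x ≡ false
    oriented : ∀ x y → arc x y ≡ true → arc y x ≡ false

module _ (D : OrientedGraph) where
  open OrientedGraph D

  Arc : Fin n → Fin n → Set
  Arc x y = arc x y ≡ true

  data Walk : Fin n → Fin n → Set where
    []  : ∀ {x} → Walk x x
    _∷_ : ∀ {x y z} → Arc x y → Walk y z → Walk x z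

  vertices : ∀ {x y} → Walk x y → List (Fin n)
  vertices {x} []      = x ∷ []
  vertices {x} (_ ∷ w) = x ∷ vertices w

  len : ∀ {x y} → Walk x y → ℕ
  len []      = 0
  len (_ ∷ w) = suc (len w)

  IsPath : ∀ {x y} → Walk x y → Set
  IsPath w = Unique (vertices w)

  StrongDiam2 : Set
  StrongDiam2 = ∀ (i j : Fin n) → i ≢ j →
    Σ (Walk i j) λ w → IsPath w × len w ≤ 2

  StronglyConnected : Set
  StronglyConnected = ∀ (x y : Fin n) → Σ (Walk x y) IsPath

  TwoConnected : Set
  TwoConnected = 3 ≤ n × StronglyConnected ×
    (∀ (v x y : Fin n) → x ≢ v → y ≢ v →
       Σ (Walk x y) λ w → IsPath w × ¬ (v ∈ vertices w))

  InF : (p q a b c r : Fin n) → Set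
  InF p q a b c r =
    TwoConnected × StrongDiam2 ×
    (p ≢ q × p ≢ a × p ≢ b × p ≢ c × p ≢ r ×
     q ≢ a × q ≢ b × q ≢ c × q ≢ r ×
     a ≢ b × a ≢ c × a ≢ r ×
     b ≢ c × b ≢ r ×
     c ≢ r) ×
    (Arc p c × Arc q c × Arc q b × Arc b r × Arc a r × Arc p a) ×
    (∀ (w : Walk p r) → IsPath w →
       (a ∈ vertices w) ⊎ ((c ∈ vertices w) × (b ∈ vertices w))) ×
    (∀ (w : Walk q r) → IsPath w →
       (b ∈ vertices w) ⊎ ((c ∈ vertices w) × (a ∈ vertices w))) ×
    (∀ (w : Walk c r) → IsPath w →
       (a ∈ vertices w) ⊎ (b ∈ vertices w))

  InFamilyF : Set
  InFamilyF = ∃[ p ] ∃[ q ] ∃[ a ] ∃[ b ] ∃[ c ] ∃[ r ] InF p q a b c r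

module Submission where

-- Take a walk of length at most 2 from q to a, given by strong diameter 2, and
-- append the arc a → r. Since b, c ∉ {q, a, r}, the path condition for q forces
-- the walk to have a middle vertex equal to b or c; it cannot be c when c ↛ a,
-- so it is b and b → a. The second claim is the same argument from p to b.

open import Defs
open import Data.Fin using (Fin)
open import Data.Nat using (s≤s)
open import Data.Product using (_×_; _,_; proj₁; ∃-syntax)
open import Data.Sum using (_⊎_; inj₁; inj₂; map₂)
open import Data.Empty using (⊥-elim)
open import Data.List using ([]; _∷_)
open import Data.List.Relation.Unary.Any using (here; there)
open import Data.List.Relation.Unary.All using ([]; _∷_)
open import Data.List.Relation.Unary.AllPairs using ([]; _∷_)
open import Data.List.Membership.Propositional using (_∈_)
open import Function using (_∘_)
open import Relation.Nullary using (¬_)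
open import Relation.Binary.PropositionalEquality
  using (_≡_; _≢_; refl; sym; trans; subst; ≢-sym)

module _ {A : Set} {v x y z : A} where

  ∉-three : v ≢ x → v ≢ y → v ≢ z → ¬ v ∈ x ∷ y ∷ z ∷ []
  ∉-three v≢x _ _ (here v≡x)                 = v≢x v≡x
  ∉-three _ v≢y _ (there (here v≡y))         = v≢y v≡y
  ∉-three _ _ v≢z (there (there (here v≡z))) = v≢z v≡z

  ∈-four⇒≡-second : ∀ {w} → v ∈ x ∷ y ∷ z ∷ w ∷ [] → v ≢ x → v ≢ z → v ≢ w → v ≡ y
  ∈-four⇒≡-second (here v≡x)                         v≢x _ _ = ⊥-elim (v≢x v≡x)
  ∈-four⇒≡-second (there (here v≡y))                 _ _ _   = v≡y
  ∈-four⇒≡-second (there (there (here v≡z)))         _ v≢z _ = ⊥-elim (v≢z v≡z)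
  ∈-four⇒≡-second (there (there (there (here v≡w)))) _ _ v≢w = ⊥-elim (v≢w v≡w)

module _ (D : OrientedGraph) where
  open OrientedGraph D

  Arc⇒≢ : ∀ {x y} → Arc D x y → x ≢ y
  Arc⇒≢ {x} x→x refl with trans (sym x→x) (loopless x)
  ... | ()

  Arc-asym : ∀ {x y} → Arc D x y → ¬ Arc D y x
  Arc-asym {x} {y} x→y y→x with trans (sym y→x) (oriented x y x→y)
  ... | ()

  StrongDiam2⇒arc-or-midpoint : StrongDiam2 D → ∀ {x z} → x ≢ z →
    Arc D x z ⊎ ∃[ y ] (Arc D x y × Arc D y z)
  StrongDiam2⇒arc-or-midpoint diam {x} {z} x≢z with diam x z x≢z
  ... | [] , _ , _                    = ⊥-elim (x≢z refl)
  ... | x→z ∷ [] , _ , _              = inj₁ x→z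
  ... | x→y ∷ y→z ∷ [] , _ , _        = inj₂ (_ , x→y , y→z)
  ... | _ ∷ _ ∷ _ ∷ _ , _ , s≤s (s≤s ())

  arc-from-forced-vertex : StrongDiam2 D → ∀ {x z r m c} →
    x ≢ z → x ≢ r → m ≢ x → m ≢ z → m ≢ r → c ≢ x → c ≢ z → c ≢ r →
    Arc D z r → ¬ Arc D c z →
    (∀ (w : Walk D x r) → IsPath D w → m ∈ vertices D w ⊎ c ∈ vertices D w) →
    Arc D m z
  arc-from-forced-vertex diam {x} {z} {r} {m} {c}
    x≢z x≢r m≢x m≢z m≢r c≢x c≢z c≢r z→r c↛z meets
    with StrongDiam2⇒arc-or-midpoint diam x≢z
  ... | inj₁ x→z with meets (x→z ∷ z→r ∷ []) ((x≢z ∷ x≢r ∷ []) ∷ (z≢r ∷ []) ∷ [] ∷ [])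
    where
      z≢r : z ≢ r
      z≢r = Arc⇒≢ z→r
  ...   | inj₁ m∈ = ⊥-elim (∉-three m≢x m≢z m≢r m∈)
  ...   | inj₂ c∈ = ⊥-elim (∉-three c≢x c≢z c≢r c∈)
  arc-from-forced-vertex diam {x} {z} {r} {m} {c}
    x≢z x≢r m≢x m≢z m≢r c≢x c≢z c≢r z→r c↛z meets
    | inj₂ (y , x→y , y→z) with meets (x→y ∷ y→z ∷ z→r ∷ []) path
    where
      y≢r : y ≢ r
      y≢r refl = Arc-asym y→z z→r
      path : IsPath D (x→y ∷ y→z ∷ z→r ∷ [])
      path = (Arc⇒≢ x→y ∷ x≢z ∷ x≢r ∷ []) ∷ (Arc⇒≢ y→z ∷ y≢r ∷ [])
           ∷ (Arc⇒≢ z→r ∷ []) ∷ [] ∷ []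
  ...   | inj₁ m∈ = subst (λ t → Arc D t z) (sym (∈-four⇒≡-second m∈ m≢x m≢z m≢r)) y→z
  ...   | inj₂ c∈ = ⊥-elim (c↛z (subst (λ t → Arc D t z)
                                      (sym (∈-four⇒≡-second c∈ c≢x c≢z c≢r)) y→z))

proposition13 : (D : OrientedGraph) (p q a b c r : Fin (OrientedGraph.n D)) →
    InF D p q a b c r →
    (¬ Arc D c a → Arc D b a) × (¬ Arc D c b → Arc D a b)
proposition13 D p q a b c r
  (_ , diam , (_ , p≢a , p≢b , p≢c , p≢r , q≢a , q≢b , q≢c , q≢r ,
               a≢b , a≢c , a≢r , b≢c , b≢r , c≢r) ,
   (_ , _ , _ , b→r , a→r , _) , from-p , from-q , _) =
    (λ c↛a → arc-from-forced-vertex D diam q≢a q≢r (≢-sym q≢b) (≢-sym a≢b) b≢r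
               (≢-sym q≢c) (≢-sym a≢c) c≢r a→r c↛a (λ w → map₂ proj₁ ∘ from-q w))
  , (λ c↛b → arc-from-forced-vertex D diam p≢b p≢r (≢-sym p≢a) a≢b a≢r
               (≢-sym p≢c) (≢-sym b≢c) c≢r b→r c↛b (λ w → map₂ proj₁ ∘ from-p w))
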